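{- Let $k\geq 2$ be an integer. For any graph $G$ of order $n$ and size $m$ with $\delta(G)\geq k$, $$\gamma_{\times k}(G)\geq \frac{(\delta(G)+k)n-2m}{\delta(G)+1}.$$
   Context: All graphs are simple (finite). For $v\in V(G)$ and $D\subseteq V(G)$, $\deg_D(v)=|N(v)\cap D|$ where $N(v)$ is the open neighbourhood. $\delta(G)$ is the minimum degree. A set $D\subseteq V(G)$ is a $k$-tuple dominating set of $G$ if $\deg_D(v)\geq k$ for every $v\in V(G)\setminus D$ and $\deg_D(v)\geq k-1$ for every $v\in D$; $\gamma_{\times k}(G)$ is the minimum cardinality of a $k$-tuple dominating set. -}

module Defs where

open import Data.Nat using (ℕ; zero; suc; _+_; _∸_; _≤_; _<_)
open import Data.Bool using (Bool; true; false; _∧_; if_then_else_)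
open import Data.Fin using (Fin; zero; suc; toℕ)
open import Data.Fin.Subset using (Subset; _∈_; _∉_; ∣_∣)
open import Data.Vec using (lookup)
open import Data.Product using (Σ; _×_; _,_)
open import Relation.Binary.PropositionalEquality using (_≡_)
open import Relation.Nullary using (¬_)

countT : ∀ {n} → (Fin n → Bool) → ℕ
countT {zero}  f = 0
countT {suc n} f = (if f zero then 1 else 0) + countT (λ i → f (suc i))

record Graph (n : ℕ) : Set where
  field
    adj   : Fin n → Fin n → Bool
    sym   : ∀ u v → adj u v ≡ adj v u
    irrefl : ∀ v → adj v v ≡ false
open Graph public

deg : ∀ {n} → Graph n → Fin n → ℕ
deg G v = countT (λ u → adj G v u)

degIn : ∀ {n} → Graph n → Subset n → Fin n → ℕ
degIn G D v = countT (λ u → adj G v u ∧ lookup D u)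

sumF : ∀ {n} → (Fin n → ℕ) → ℕ
sumF {zero}  f = 0
sumF {suc n} f = f zero + sumF (λ i → f (suc i))

ltB : ℕ → ℕ → Bool
ltB zero    (suc _) = true
ltB _       zero    = false
ltB (suc a) (suc b) = ltB a b

size : ∀ {n} → Graph n → ℕ
size G = sumF (λ u → countT (λ v → ltB (toℕ u) (toℕ v) ∧ adj G u v))

IsMinDegree : ∀ {n} → Graph n → ℕ → Set
IsMinDegree G δ = (∀ v → δ ≤ deg G v) × Σ _ (λ v → deg G v ≡ δ)

IsKTupleDom : ∀ {n} → ℕ → Graph n → Subset n → Set
IsKTupleDom k G D =
  (∀ v → v ∉ D → k ≤ degIn G D v) × (∀ v → v ∈ D → k ∸ 1 ≤ degIn G D v)

IsKTupleDomNumber : ∀ {n} → ℕ → Graph n → ℕ → Set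
IsKTupleDomNumber k G γ =
  Σ _ (λ D → IsKTupleDom k G D × ∣ D ∣ ≡ γ) × (∀ D → IsKTupleDom k G D → γ ≤ ∣ D ∣)

-- Let D be a k-tuple dominating set and give each vertex the weight k − 1 if it lies in D and
-- δ + k otherwise. A vertex v ∈ D has deg v ≥ (k − 1) + (number of its neighbours outside D), and a
-- vertex v ∉ D has deg v + deg_D v ≥ δ + k. Summing over all vertices, the edges between D and its
-- complement appear once on each side and cancel, so the total weight (δ + k) n − (δ + 1) |D| is at
-- most Σ deg v = 2m.
module Submission where

open import Data.Bool using (Bool; true; false; _∧_; not; if_then_else_)
open import Data.Bool.Properties using (∧-comm; ∧-zeroʳ)
open import Data.Empty using (⊥-elim)
open import Data.Fin using (Fin; toℕ; _≟_)
open import Data.Fin.Properties using (toℕ-injective)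
open import Data.Fin.Subset using (Subset; _∉_; ∣_∣)
open import Data.Nat using (ℕ; zero; suc; _+_; _*_; _∸_; _≤_; z≤n)
open import Data.Nat.Properties
  using ( +-*-semiring; *-commutativeSemigroup; +-comm; +-assoc; +-identityʳ; *-comm
        ; *-identityˡ; *-identityʳ; *-zeroʳ; +-mono-≤; +-monoˡ-≤; +-cancelʳ-≤; m+[n∸m]≡n; <⇒≤
        ; module ≤-Reasoning )
open import Data.Product using (_,_)
open import Data.Vec using ([]; _∷_; lookup)
open import Data.Vec.Properties using (lookup⇒[]=; []=⇒lookup)
open import Function using (_∘_)
open import Relation.Binary.PropositionalEquality
  using (_≡_; _≢_; refl; sym; trans; cong; cong₂; module ≡-Reasoning)
open import Relation.Nullary using (yes; no)
open import Algebra.Properties.Semiring.Sum +-*-semiring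
  using (sum; sum-cong-≗; ∑-distrib-+; ∑-comm; *-distribˡ-sum)
open import Algebra.Properties.CommutativeSemigroup *-commutativeSemigroup using (x∙yz≈z∙yx)

open import Defs hiding (sym)

𝟙 : Bool → ℕ
𝟙 true  = 1
𝟙 false = 0

𝟙-split : ∀ a b → 𝟙 a ≡ 𝟙 (a ∧ b) + 𝟙 (a ∧ not b)
𝟙-split true  true  = refl
𝟙-split true  false = refl
𝟙-split false _     = refl

sumF≡sum : ∀ {n} (f : Fin n → ℕ) → sumF f ≡ sum f
sumF≡sum {zero}  f = refl
sumF≡sum {suc n} f = cong (f Fin.zero +_) (sumF≡sum (f ∘ Fin.suc))

countT≡sum : ∀ {n} (p : Fin n → Bool) → countT p ≡ sum (𝟙 ∘ p)
countT≡sum {zero}  p = refl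
countT≡sum {suc n} p with p Fin.zero
... | true  = cong suc (countT≡sum (p ∘ Fin.suc))
... | false = countT≡sum (p ∘ Fin.suc)

∣p∣≡sum : ∀ {n} (p : Subset n) → ∣ p ∣ ≡ sum (𝟙 ∘ lookup p)
∣p∣≡sum []          = refl
∣p∣≡sum (true  ∷ p) = cong suc (∣p∣≡sum p)
∣p∣≡sum (false ∷ p) = ∣p∣≡sum p

sum-const : ∀ n c → sum {n} (λ _ → c) ≡ n * c
sum-const zero    c = refl
sum-const (suc n) c = cong (c +_) (sum-const n c)

sum-mono-≤ : ∀ {n} {f g : Fin n → ℕ} → (∀ i → f i ≤ g i) → sum f ≤ sum g
sum-mono-≤ {zero}  f≤g = z≤n
sum-mono-≤ {suc n} f≤g = +-mono-≤ (f≤g Fin.zero) (sum-mono-≤ (f≤g ∘ Fin.suc))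

ltB-flip : ∀ a b → a ≢ b → ltB b a ≡ not (ltB a b)
ltB-flip zero    zero    a≢b = ⊥-elim (a≢b refl)
ltB-flip zero    (suc b) _   = refl
ltB-flip (suc a) zero    _   = refl
ltB-flip (suc a) (suc b) a≢b = ltB-flip a b (a≢b ∘ cong suc)

module _ {n} (G : Graph n) where

  private
    forwardEdge : Fin n → Fin n → Bool
    forwardEdge u v = ltB (toℕ u) (toℕ v) ∧ adj G u v

  𝟙-adj-split : ∀ u v → 𝟙 (adj G u v) ≡ 𝟙 (forwardEdge u v) + 𝟙 (forwardEdge v u)
  𝟙-adj-split u v with u ≟ v
  ... | yes refl rewrite irrefl G u | ∧-zeroʳ (ltB (toℕ u) (toℕ u)) = refl
  ... | no u≢v
    rewrite Graph.sym G v u | ltB-flip (toℕ u) (toℕ v) (u≢v ∘ toℕ-injective)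
          | ∧-comm (ltB (toℕ u) (toℕ v)) (adj G u v)
          | ∧-comm (not (ltB (toℕ u) (toℕ v))) (adj G u v)
    = 𝟙-split (adj G u v) (ltB (toℕ u) (toℕ v))

  size≡sum : size G ≡ sum (λ u → sum (𝟙 ∘ forwardEdge u))
  size≡sum = trans (sumF≡sum (countT ∘ forwardEdge)) (sum-cong-≗ (λ u → countT≡sum (forwardEdge u)))

  handshake : sum (deg G) ≡ 2 * size G
  handshake = begin
    sum (deg G)                                     ≡⟨ sum-cong-≗ (countT≡sum ∘ adj G) ⟩
    sum (λ u → sum (λ v → 𝟙 (adj G u v)))           ≡⟨ sum-cong-≗ split ⟩
    sum (λ u → out u + sum (λ v → backward u v))    ≡⟨ ∑-distrib-+ out (λ u → sum (backward u)) ⟩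
    sum out + sum (λ u → sum (λ v → backward u v))  ≡⟨ cong (sum out +_) (∑-comm backward) ⟩
    sum out + sum out                               ≡⟨ cong (λ s → s + s) (sym size≡sum) ⟩
    size G + size G                                 ≡⟨ cong (size G +_) (sym (+-identityʳ (size G))) ⟩
    2 * size G                                      ∎
    where
    open ≡-Reasoning
    out : Fin n → ℕ
    out u = sum (𝟙 ∘ forwardEdge u)
    backward : Fin n → Fin n → ℕ
    backward u v = 𝟙 (forwardEdge v u)
    split : ∀ u → sum (𝟙 ∘ adj G u) ≡ out u + sum (backward u)
    split u = trans (sum-cong-≗ (𝟙-adj-split u)) (∑-distrib-+ (𝟙 ∘ forwardEdge u) (backward u))

𝟙-∧ : ∀ a b → 𝟙 (a ∧ b) ≡ 𝟙 a * 𝟙 b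
𝟙-∧ true  true  = refl
𝟙-∧ true  false = refl
𝟙-∧ false _     = refl

sum-𝟙*countT-swap : ∀ {n} (R : Fin n → Fin n → Bool) → (∀ u v → R u v ≡ R v u) →
  (P Q : Fin n → Bool) →
  sum (λ v → 𝟙 (P v) * countT (λ u → R v u ∧ Q u)) ≡ sum (λ u → 𝟙 (Q u) * countT (λ v → R u v ∧ P v))
sum-𝟙*countT-swap {n} R R-sym P Q = begin
  sum (λ v → 𝟙 (P v) * countT (λ u → R v u ∧ Q u))   ≡⟨ sum-cong-≗ (expand P Q) ⟩
  sum (λ v → sum (λ u → 𝟙 (P v) * 𝟙 (R v u ∧ Q u)))  ≡⟨ ∑-comm (λ v u → 𝟙 (P v) * 𝟙 (R v u ∧ Q u)) ⟩
  sum (λ u → sum (λ v → 𝟙 (P v) * 𝟙 (R v u ∧ Q u)))  ≡⟨ sum-cong-≗ (λ u → sum-cong-≗ (λ v → swap v u)) ⟩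
  sum (λ u → sum (λ v → 𝟙 (Q u) * 𝟙 (R u v ∧ P v)))  ≡⟨ sum-cong-≗ (expand Q P) ⟨
  sum (λ u → 𝟙 (Q u) * countT (λ v → R u v ∧ P v))   ∎
  where
  open ≡-Reasoning
  expand : ∀ A B v → 𝟙 (A v) * countT (λ u → R v u ∧ B u) ≡ sum (λ u → 𝟙 (A v) * 𝟙 (R v u ∧ B u))
  expand A B v = trans (cong (𝟙 (A v) *_) (countT≡sum (λ u → R v u ∧ B u)))
                       (*-distribˡ-sum (𝟙 (A v)) (λ u → 𝟙 (R v u ∧ B u)))
  swap : ∀ v u → 𝟙 (P v) * 𝟙 (R v u ∧ Q u) ≡ 𝟙 (Q u) * 𝟙 (R u v ∧ P v)
  swap v u rewrite 𝟙-∧ (R v u) (Q u) | 𝟙-∧ (R u v) (P v) | R-sym u v =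
    x∙yz≈z∙yx (𝟙 (P v)) (𝟙 (R v u)) (𝟙 (Q u))

module _ {n} (G : Graph n) (D : Subset n) where

  degOut : Fin n → ℕ
  degOut v = countT (λ u → adj G v u ∧ not (lookup D u))

  deg≡degIn+degOut : ∀ v → deg G v ≡ degIn G D v + degOut v
  deg≡degIn+degOut v = begin
    deg G v                                ≡⟨ countT≡sum (adj G v) ⟩
    sum (𝟙 ∘ adj G v)                      ≡⟨ sum-cong-≗ (λ u → 𝟙-split (adj G v u) (lookup D u)) ⟩
    sum (λ u → 𝟙 (inD u) + 𝟙 (outD u))     ≡⟨ ∑-distrib-+ (𝟙 ∘ inD) (𝟙 ∘ outD) ⟩
    sum (𝟙 ∘ inD) + sum (𝟙 ∘ outD)         ≡⟨ cong₂ _+_ (countT≡sum inD) (countT≡sum outD) ⟨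
    degIn G D v + degOut v                 ∎
    where
    open ≡-Reasoning
    inD outD : Fin n → Bool
    inD  u = adj G v u ∧ lookup D u
    outD u = adj G v u ∧ not (lookup D u)

  sum-degOut≡sum-degIn :
    sum (λ v → 𝟙 (lookup D v) * degOut v) ≡ sum (λ v → 𝟙 (not (lookup D v)) * degIn G D v)
  sum-degOut≡sum-degIn = sum-𝟙*countT-swap (adj G) (Graph.sym G) (lookup D) (not ∘ lookup D)

module _ {n} (G : Graph n) (D : Subset n) (k δ : ℕ) where

  weight : Fin n → ℕ
  weight v = if lookup D v then k ∸ 1 else δ + k

  weight+degOut≤deg+degIn : (∀ v → δ ≤ deg G v) → IsKTupleDom k G D →
    ∀ v → weight v + 𝟙 (lookup D v) * degOut G D v ≤ deg G v + 𝟙 (not (lookup D v)) * degIn G D v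
  weight+degOut≤deg+degIn minDeg (dominated , dominatedIn) v with lookup D v in v∈?D
  ... | true = begin
    k ∸ 1 + 1 * degOut G D v      ≡⟨ cong (k ∸ 1 +_) (*-identityˡ (degOut G D v)) ⟩
    k ∸ 1 + degOut G D v          ≤⟨ +-monoˡ-≤ (degOut G D v) (dominatedIn v (lookup⇒[]= v D v∈?D)) ⟩
    degIn G D v + degOut G D v    ≡⟨ deg≡degIn+degOut G D v ⟨
    deg G v                       ≡⟨ +-identityʳ (deg G v) ⟨
    deg G v + 0                   ∎
    where open ≤-Reasoning
  ... | false = begin
    δ + k + 0                     ≡⟨ +-identityʳ (δ + k) ⟩
    δ + k                         ≤⟨ +-mono-≤ (minDeg v) (dominated v v∉D) ⟩
    deg G v + degIn G D v         ≡⟨ cong (deg G v +_) (*-identityˡ (degIn G D v)) ⟨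
    deg G v + 1 * degIn G D v     ∎
    where
    open ≤-Reasoning
    v∉D : v ∉ D
    v∉D v∈D with trans (sym ([]=⇒lookup v∈D)) v∈?D
    ... | ()

  sum-weight≤sum-deg : (∀ v → δ ≤ deg G v) → IsKTupleDom k G D → sum weight ≤ sum (deg G)
  sum-weight≤sum-deg minDeg isDom = +-cancelʳ-≤ cut (sum weight) (sum (deg G)) (begin
    sum weight + cut
      ≡⟨ ∑-distrib-+ weight (λ v → 𝟙 (lookup D v) * degOut G D v) ⟨
    sum (λ v → weight v + 𝟙 (lookup D v) * degOut G D v)
      ≤⟨ sum-mono-≤ (weight+degOut≤deg+degIn minDeg isDom) ⟩
    sum (λ v → deg G v + 𝟙 (not (lookup D v)) * degIn G D v)
      ≡⟨ ∑-distrib-+ (deg G) (λ v → 𝟙 (not (lookup D v)) * degIn G D v) ⟩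
    sum (deg G) + sum (λ v → 𝟙 (not (lookup D v)) * degIn G D v)
      ≡⟨ cong (sum (deg G) +_) (sum-degOut≡sum-degIn G D) ⟨
    sum (deg G) + cut ∎)
    where
    open ≤-Reasoning
    cut : ℕ
    cut = sum (λ v → 𝟙 (lookup D v) * degOut G D v)

  weight+[δ+1]*𝟙≡δ+k : 1 ≤ k → ∀ v → weight v + (δ + 1) * 𝟙 (lookup D v) ≡ δ + k
  weight+[δ+1]*𝟙≡δ+k 1≤k v with lookup D v
  ... | true = begin
    k ∸ 1 + (δ + 1) * 1    ≡⟨ cong (k ∸ 1 +_) (*-identityʳ (δ + 1)) ⟩
    k ∸ 1 + (δ + 1)        ≡⟨ +-comm (k ∸ 1) (δ + 1) ⟩
    δ + 1 + (k ∸ 1)        ≡⟨ +-assoc δ 1 (k ∸ 1) ⟩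
    δ + (1 + (k ∸ 1))      ≡⟨ cong (δ +_) (m+[n∸m]≡n 1≤k) ⟩
    δ + k                  ∎
    where open ≡-Reasoning
  ... | false = trans (cong (δ + k +_) (*-zeroʳ (δ + 1))) (+-identityʳ (δ + k))

  sum-weight+[δ+1]*∣D∣≡n*[δ+k] : 1 ≤ k → sum weight + (δ + 1) * ∣ D ∣ ≡ n * (δ + k)
  sum-weight+[δ+1]*∣D∣≡n*[δ+k] 1≤k = begin
    sum weight + (δ + 1) * ∣ D ∣                 ≡⟨ cong (λ c → sum weight + (δ + 1) * c) (∣p∣≡sum D) ⟩
    sum weight + (δ + 1) * sum inD              ≡⟨ cong (sum weight +_) (*-distribˡ-sum (δ + 1) inD) ⟩
    sum weight + sum (λ v → (δ + 1) * inD v)    ≡⟨ ∑-distrib-+ weight (λ v → (δ + 1) * inD v) ⟨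
    sum (λ v → weight v + (δ + 1) * inD v)      ≡⟨ sum-cong-≗ (weight+[δ+1]*𝟙≡δ+k 1≤k) ⟩
    sum {n} (λ _ → δ + k)                       ≡⟨ sum-const n (δ + k) ⟩
    n * (δ + k)                                 ∎
    where
    open ≡-Reasoning
    inD : Fin n → ℕ
    inD = 𝟙 ∘ lookup D

  kTupleDom-lowerBound : 1 ≤ k → (∀ v → δ ≤ deg G v) → IsKTupleDom k G D →
    (δ + k) * n ≤ ∣ D ∣ * (δ + 1) + 2 * size G
  kTupleDom-lowerBound 1≤k minDeg isDom = begin
    (δ + k) * n                                ≡⟨ *-comm (δ + k) n ⟩
    n * (δ + k)                                ≡⟨ sum-weight+[δ+1]*∣D∣≡n*[δ+k] 1≤k ⟨
    sum weight + (δ + 1) * ∣ D ∣               ≤⟨ +-monoˡ-≤ _ (sum-weight≤sum-deg minDeg isDom) ⟩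
    sum (deg G) + (δ + 1) * ∣ D ∣              ≡⟨ cong₂ _+_ (handshake G) (*-comm (δ + 1) ∣ D ∣) ⟩
    2 * size G + ∣ D ∣ * (δ + 1)               ≡⟨ +-comm (2 * size G) (∣ D ∣ * (δ + 1)) ⟩
    ∣ D ∣ * (δ + 1) + 2 * size G               ∎
    where open ≤-Reasoning

proposition3 : (k : ℕ) → 2 ≤ k → (n : ℕ) → (G : Graph n) → (δ : ℕ) → IsMinDegree G δ → k ≤ δ → (γ : ℕ) → IsKTupleDomNumber k G γ → (δ + k) * n ≤ γ * (δ + 1) + 2 * size G
proposition3 k 2≤k n G δ (minDeg , _) _ γ ((D , isDom , refl) , _) =
  kTupleDom-lowerBound G D k δ (<⇒≤ 2≤k) minDeg isDom
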